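{- Let $A^{\tau}(t,z)=\sum_{n,k\ge0}a^{\tau}_{n,k}t^nz^k$, where $a^{\tau}_{n,k}$ is the number of permutations in $S_n$ avoiding the classical pattern $3\textrm{ - }1\textrm{ - }2$ and containing exactly $k$ occurrences of the consecutive pattern $\tau$. Then $A^{123}(t,z)=A^{321}(t,z)$.
   Context: A permutation $\sigma\in S_n$ avoids the classical pattern $3\textrm{ - }1\textrm{ - }2$ if there are no indices $i<j<l$ with $\sigma(j)<\sigma(l)<\sigma(i)$. An occurrence of the consecutive pattern $123$ (resp. $321$) in $\sigma$ is an index $i$ with $\sigma(i)<\sigma(i+1)<\sigma(i+2)$ (resp. $\sigma(i)>\sigma(i+1)>\sigma(i+2)$). -}

module Defs where

open import Data.Nat using (ℕ; zero; suc; _+_; _<ᵇ_; _≡ᵇ_)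
open import Data.Bool using (Bool; true; false; _∧_; _∨_; not; if_then_else_)
open import Data.List using (List; []; _∷_; [_]; map; concatMap)
open import Data.Bool.ListAction using (any)
open import Data.Fin using (Fin; toℕ)
open import Data.List using (allFin)

-- A permutation σ ∈ S_n is represented by its one-line notation
-- σ(1) … σ(n), i.e. a list of length n with distinct entries in {0,…,n-1}.

words : (n m : ℕ) → List (List ℕ)
words n zero    = [ [] ]
words n (suc m) = concatMap (λ i → map (toℕ i ∷_) (words n m)) (allFin n)

distinct : List ℕ → Bool
distinct []       = true
distinct (x ∷ xs) = not (any (λ y → x ≡ᵇ y) xs) ∧ distinct xs

-- The words of length n over {0,…,n-1} with distinct entries: exactly S_n.
isPerm : List ℕ → Bool
isPerm = distinct

has12below : ℕ → List ℕ → Bool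
has12below x []       = false
has12below x (y ∷ zs) = any (λ z → (y <ᵇ z) ∧ (z <ᵇ x)) zs ∨ has12below x zs

avoids312 : List ℕ → Bool
avoids312 []       = true
avoids312 (x ∷ xs) = not (has12below x xs) ∧ avoids312 xs

occ123 : List ℕ → ℕ
occ123 (a ∷ b ∷ c ∷ rest) =
  (if (a <ᵇ b) ∧ (b <ᵇ c) then 1 else 0) + occ123 (b ∷ c ∷ rest)
occ123 _ = 0

occ321 : List ℕ → ℕ
occ321 (a ∷ b ∷ c ∷ rest) =
  (if (b <ᵇ a) ∧ (c <ᵇ b) then 1 else 0) + occ321 (b ∷ c ∷ rest)
occ321 _ = 0

countB : {A : Set} → (A → Bool) → List A → ℕ
countB p []       = 0
countB p (x ∷ xs) = (if p x then 1 else 0) + countB p xs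

-- a^τ_{n,k}: number of σ ∈ S_n avoiding 3-1-2 with exactly k occurrences
-- of the consecutive pattern τ (τ given by its occurrence-counting function).
a : (occ : List ℕ → ℕ) → ℕ → ℕ → ℕ
a occ n k = countB (λ σ → isPerm σ ∧ avoids312 σ ∧ (occ σ ≡ᵇ k)) (words n n)

-- A 312-avoiding permutation of {0, …, n − 1} is a binary tree in disguise: the entry 0 is
-- the root, the entries before it are 1, …, k (an entry after 0 below one before 0 would form
-- a 312 with 0), and the two blocks around 0 are again 312-avoiding, giving the subtrees. Mirroring
-- the tree swaps the blocks. Since 0 lies below everything, the 123s of the permutation of t
-- are those inside the blocks plus an initial ascent of the right block, and the 321s of the
-- permutation of the mirror image are those inside its blocks plus a final descent of its left
-- block; by induction the two counts agree. Transported to permutations and extended by the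
-- identity to all other words, mirroring is an involution of the words of length n that
-- carries the 123-statistic to the 321-statistic, so both are counted equally.

module Submission where

open import Defs

open import Data.Bool using (Bool; true; false; _∧_; _∨_; not; if_then_else_; T)
open import Data.Bool.Properties using (T-∧; T-∨; T-≡; ∧-zeroʳ; ∧-identityʳ)
open import Data.Bool.ListAction using (any; or)
open import Data.Empty using (⊥; ⊥-elim)
open import Data.Fin using (toℕ; fromℕ<)
open import Data.Fin.Properties using (toℕ<n; toℕ-fromℕ<; toℕ-injective)
open import Data.List using (List; []; _∷_; [_]; map; _++_; length; null; allFin)
open import Data.List.Properties
  using (map-∘; map-cong; map-id-local; map-injective; length-++; length-map; length-++-sucʳ;
         ++-assoc; ++-conicalʳ; ∷-injective; ∷-injectiveˡ; ∷-injectiveʳ)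
open import Data.List.Membership.Propositional using (_∈_; _∉_; find; lose)
open import Data.List.Membership.Propositional.Properties
  using (∈-++⁻; ∈-++⁺ˡ; ∈-++⁺ʳ; ∈-∃++; ∈-map⁻; ∈-map⁺; ∈-concatMap⁻; ∈-concatMap⁺; ∈-allFin)
open import Data.List.Membership.Propositional.Properties.WithK using (unique∧set⇒bag)
open import Data.List.Relation.Binary.BagAndSetEquality using (∼bag⇒↭)
open import Data.List.Relation.Binary.Disjoint.Propositional using (Disjoint)
open import Data.List.Relation.Binary.Permutation.Propositional
  using (_↭_; prep; swap) renaming (refl to ↭-refl; trans to ↭-trans)
open import Data.List.Relation.Unary.All as All using (All; []; _∷_)
open import Data.List.Relation.Unary.All.Properties using (++⁺; ++⁻ˡ; ++⁻ʳ; map⁺)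
import Data.List.Relation.Unary.AllPairs as AllPairs
import Data.List.Relation.Unary.AllPairs.Properties as AllPairs
open import Data.List.Relation.Unary.AllPairs using ([]; _∷_; tail)
open import Data.List.Relation.Unary.Any using (here; there)
import Data.List.Relation.Unary.Any.Properties as Any
open import Data.List.Relation.Unary.Any.Properties using (any⁺; any⁻)
open import Data.List.Relation.Unary.Unique.Propositional using (Unique)
import Data.List.Relation.Unary.Unique.Propositional.Properties as UP
open import Data.Nat using (ℕ; zero; suc; _+_; _∸_; _<ᵇ_; _≡ᵇ_; _≤_; _<_; z≤n; s≤s; s≤s⁻¹; z<s)
open import Data.Nat.Induction using (<-wellFounded)
open import Data.Nat.Properties
open import Data.List.Membership.DecPropositional _≟_ using (_∈?_)
open import Data.List.Relation.Unary.Unique.DecPropositional _≟_ using (unique?)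
open import Data.Product using (_×_; _,_; proj₁; proj₂; ∃; ∃₂)
open import Data.Sum using (_⊎_; inj₁; inj₂)
open import Function using (_∘_; case_of_; Equivalence; mk⇔)
open import Induction.WellFounded using (Acc; acc)
open import Relation.Binary.PropositionalEquality hiding ([_])
open import Relation.Nullary using (¬_; Dec; yes; no; map′; _×-dec_)
open import Relation.Nullary.Decidable using (T?)
open import Algebra.Properties.CommutativeSemigroup +-commutativeSemigroup using (x∙yz≈y∙xz)

+-cancelˡ-<ᵇ : ∀ c x y → (c + x <ᵇ c + y) ≡ (x <ᵇ y)
+-cancelˡ-<ᵇ zero    x y = refl
+-cancelˡ-<ᵇ (suc c) x y = +-cancelˡ-<ᵇ c x y

indicator : Bool → ℕ
indicator b = if b then 1 else 0

initialAscent : List ℕ → ℕ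
initialAscent (x ∷ y ∷ _) = indicator (x <ᵇ y)
initialAscent _           = 0

finalDescent : List ℕ → ℕ
finalDescent (x ∷ y ∷ [])    = indicator (y <ᵇ x)
finalDescent (_ ∷ y ∷ z ∷ r) = finalDescent (y ∷ z ∷ r)
finalDescent _               = 0

-- The statistics only compare entries, so they are invariant under any map preserving <.
module OrderEmbedding (f : ℕ → ℕ) (f-<ᵇ : ∀ x y → (f x <ᵇ f y) ≡ (x <ᵇ y)) where

  has12below-map : ∀ x ys → has12below (f x) (map f ys) ≡ has12below x ys
  has12below-map x []       = refl
  has12below-map x (y ∷ zs) = cong₂ _∨_ any-map (has12below-map x zs)
    where
    any-map : any (λ z → (f y <ᵇ z) ∧ (z <ᵇ f x)) (map f zs) ≡ any (λ z → (y <ᵇ z) ∧ (z <ᵇ x)) zs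
    any-map = cong or
      (trans (sym (map-∘ zs)) (map-cong (λ z → cong₂ _∧_ (f-<ᵇ y z) (f-<ᵇ z x)) zs))

  avoids312-map : ∀ xs → avoids312 (map f xs) ≡ avoids312 xs
  avoids312-map []       = refl
  avoids312-map (x ∷ xs) = cong₂ (λ h a → not h ∧ a) (has12below-map x xs) (avoids312-map xs)

  occ123-map : ∀ xs → occ123 (map f xs) ≡ occ123 xs
  occ123-map []            = refl
  occ123-map (_ ∷ [])      = refl
  occ123-map (_ ∷ _ ∷ [])  = refl
  occ123-map (x ∷ y ∷ z ∷ r) =
    cong₂ _+_ (cong indicator (cong₂ _∧_ (f-<ᵇ x y) (f-<ᵇ y z))) (occ123-map (y ∷ z ∷ r))

  occ321-map : ∀ xs → occ321 (map f xs) ≡ occ321 xs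
  occ321-map []            = refl
  occ321-map (_ ∷ [])      = refl
  occ321-map (_ ∷ _ ∷ [])  = refl
  occ321-map (x ∷ y ∷ z ∷ r) =
    cong₂ _+_ (cong indicator (cong₂ _∧_ (f-<ᵇ y x) (f-<ᵇ z y))) (occ321-map (y ∷ z ∷ r))

  finalDescent-map : ∀ xs → finalDescent (map f xs) ≡ finalDescent xs
  finalDescent-map []              = refl
  finalDescent-map (_ ∷ [])        = refl
  finalDescent-map (x ∷ y ∷ [])    = cong indicator (f-<ᵇ y x)
  finalDescent-map (_ ∷ y ∷ z ∷ r) = finalDescent-map (y ∷ z ∷ r)

module Shift (c : ℕ) = OrderEmbedding (c +_) (+-cancelˡ-<ᵇ c)

avoids312-∷⁻ : ∀ x xs → T (avoids312 (x ∷ xs)) → ¬ T (has12below x xs) × T (avoids312 xs)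
avoids312-∷⁻ x xs av with has12below x xs
... | false = (λ ()) , av

avoids312-∷⁺ : ∀ x xs → ¬ T (has12below x xs) → T (avoids312 xs) → T (avoids312 (x ∷ xs))
avoids312-∷⁺ x xs ¬h av with has12below x xs
... | false = av
... | true  = ⊥-elim (¬h _)

has12below-++⁺ˡ : ∀ x xs {ys} → T (has12below x xs) → T (has12below x (xs ++ ys))
has12below-++⁺ˡ x (y ∷ xs) h with Equivalence.to T-∨ h
... | inj₁ p = Equivalence.from T-∨ (inj₁ (any⁺ _ (Any.++⁺ˡ (any⁻ _ xs p))))
... | inj₂ q = Equivalence.from T-∨ (inj₂ (has12below-++⁺ˡ x xs q))

has12below-++⁺ʳ : ∀ x xs {ys} → T (has12below x ys) → T (has12below x (xs ++ ys))
has12below-++⁺ʳ x []       h = h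
has12below-++⁺ʳ x (_ ∷ xs) h = Equivalence.from T-∨ (inj₂ (has12below-++⁺ʳ x xs h))

has12below-++⁻ : ∀ x xs {ys} → T (has12below x (xs ++ ys)) →
  T (has12below x xs) ⊎ (∃₂ λ y z → y ∈ xs × z ∈ ys × y < z × z < x) ⊎ T (has12below x ys)
has12below-++⁻ x []       h = inj₂ (inj₂ h)
has12below-++⁻ x (y ∷ xs) h with Equivalence.to T-∨ h
... | inj₁ p with Any.++⁻ xs (any⁻ _ (xs ++ _) p)
...   | inj₁ q = inj₁ (Equivalence.from T-∨ (inj₁ (any⁺ _ q)))
...   | inj₂ q with find q
...     | z , z∈ys , y<z<x with Equivalence.to T-∧ y<z<x
...       | y<z , z<x = inj₂ (inj₁ (y , z , here refl , z∈ys , <ᵇ⇒< y z y<z , <ᵇ⇒< z x z<x))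
has12below-++⁻ x (y ∷ xs) h | inj₂ q with has12below-++⁻ x xs q
... | inj₁ r                           = inj₁ (Equivalence.from T-∨ (inj₂ r))
... | inj₂ (inj₁ (y' , z , m , rest)) = inj₂ (inj₁ (y' , z , there m , rest))
... | inj₂ (inj₂ r)                    = inj₂ (inj₂ r)

has12below-below : ∀ x ys → T (has12below x ys) → ∃ λ z → z ∈ ys × z < x
has12below-below x (y ∷ zs) h with Equivalence.to T-∨ h
... | inj₂ q = let z , z∈zs , z<x = has12below-below x zs q in z , there z∈zs , z<x
... | inj₁ p with find (any⁻ _ zs p)
...   | z , z∈zs , y<z<x = z , there z∈zs , <ᵇ⇒< z x (proj₂ (Equivalence.to T-∧ y<z<x))

avoids312-++⁻ : ∀ xs ys → T (avoids312 (xs ++ ys)) →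
  T (avoids312 xs) × T (avoids312 ys) × (∀ {x} → x ∈ xs → ¬ T (has12below x ys))
avoids312-++⁻ []       ys av = _ , av , λ ()
avoids312-++⁻ (x ∷ xs) ys av with avoids312-∷⁻ x (xs ++ ys) av
... | ¬h , av' with avoids312-++⁻ xs ys av'
...   | avxs , avys , above =
  avoids312-∷⁺ x xs (¬h ∘ has12below-++⁺ˡ x xs) avxs , avys ,
  λ { (here refl) → ¬h ∘ has12below-++⁺ʳ x xs ; (there m) → above m }

avoids312-++⁺ : ∀ xs ys → T (avoids312 xs) → T (avoids312 ys) →
  (∀ {x} → x ∈ xs → ¬ T (has12below x ys)) →
  (∀ {x y z} → x ∈ xs → y ∈ xs → z ∈ ys → y < z → z < x → ⊥) →
  T (avoids312 (xs ++ ys))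
avoids312-++⁺ []       ys avxs avys above cross = avys
avoids312-++⁺ (x ∷ xs) ys avxs avys above cross with avoids312-∷⁻ x xs avxs
... | ¬h , avxs' = avoids312-∷⁺ x (xs ++ ys) ¬h' (avoids312-++⁺ xs ys avxs' avys (above ∘ there)
                     (λ mx my → cross (there mx) (there my)))
  where
  ¬h' : ¬ T (has12below x (xs ++ ys))
  ¬h' h with has12below-++⁻ x xs h
  ... | inj₁ r                                      = ¬h r
  ... | inj₂ (inj₁ (y , z , y∈xs , z∈ys , y<z , z<x)) = cross (here refl) (there y∈xs) z∈ys y<z z<x
  ... | inj₂ (inj₂ r)                               = above (here refl) r

-- Duplicate-free lists and the pigeonhole principle

distinct⇒Unique : ∀ xs → T (distinct xs) → Unique xs
distinct⇒Unique []       _ = []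
distinct⇒Unique (x ∷ xs) d with any (x ≡ᵇ_) xs in e
... | false = All.tabulate (λ {y} y∈xs x≡y → subst T e (any⁺ _ (lose y∈xs (≡⇒≡ᵇ x y x≡y))))
            ∷ distinct⇒Unique xs d

Unique⇒distinct : ∀ {xs} → Unique xs → T (distinct xs)
Unique⇒distinct {[]}     []         = _
Unique⇒distinct {x ∷ xs} (x∉ ∷ u) with any (x ≡ᵇ_) xs in e
... | false = Unique⇒distinct u
... | true  with find (any⁻ _ xs (subst T (sym e) _))
...   | y , y∈xs , x≡ᵇy = ⊥-elim (All.lookup x∉ y∈xs (≡ᵇ⇒≡ x y x≡ᵇy))

∈-++-∷⁺ : ∀ {A : Set} (as : List A) {h bs y} → y ∈ as ++ bs → y ∈ as ++ h ∷ bs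
∈-++-∷⁺ as m with ∈-++⁻ as m
... | inj₁ p = ∈-++⁺ˡ p
... | inj₂ q = ∈-++⁺ʳ as (there q)

Unique-++⁻ : ∀ {A : Set} (xs : List A) {ys} → Unique (xs ++ ys) → Unique xs × Unique ys × Disjoint xs ys
Unique-++⁻ []       u = [] , u , λ ()
Unique-++⁻ (x ∷ xs) (x∉ ∷ u) with Unique-++⁻ xs u
... | uxs , uys , disj = ++⁻ˡ xs x∉ ∷ uxs , uys ,
  λ { (here refl , v∈ys) → All.lookup (++⁻ʳ xs x∉) v∈ys refl ; (there v∈xs , v∈ys) → disj (v∈xs , v∈ys) }

length-++-∷ : ∀ {A : Set} (xs : List A) {y ys} → length (xs ++ y ∷ ys) ≡ suc (length xs + length ys)
length-++-∷ xs {y} {ys} = trans (length-++-sucʳ xs y ys) (cong suc (length-++ xs))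

Unique-bounded⇒length≤ : ∀ lo hi {xs} → Unique xs → All (λ y → lo ≤ y × y < hi) xs → length xs ≤ hi ∸ lo
Unique-bounded⇒length≤ lo zero    {[]}    _ _                = z≤n
Unique-bounded⇒length≤ lo zero    {_ ∷ _} _ ((_ , ()) ∷ _)
Unique-bounded⇒length≤ lo (suc h) {xs}    u inRange with h ∈? xs
... | no h∉xs = ≤-trans (Unique-bounded⇒length≤ lo h u below-h) (∸-monoˡ-≤ lo (n≤1+n h))
  where
  below-h : All (λ y → lo ≤ y × y < h) xs
  below-h = All.tabulate (λ {y} y∈xs → let lo≤y , y≤h = All.lookup inRange y∈xs in
    lo≤y , ≤∧≢⇒< (≤-pred y≤h) (λ { refl → h∉xs y∈xs }))
... | yes h∈xs with ∈-∃++ h∈xs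
...   | as , bs , refl with Unique-++⁻ as u
...     | uas , h∉bs ∷ ubs , disj = begin
  length (as ++ h ∷ bs)     ≡⟨ length-++-sucʳ as h bs ⟩
  suc (length (as ++ bs))   ≤⟨ s≤s (Unique-bounded⇒length≤ lo h rest-unique below-h) ⟩
  suc (h ∸ lo)              ≡⟨ sym (+-∸-assoc 1 lo≤h) ⟩
  suc h ∸ lo ∎
  where
  open ≤-Reasoning
  lo≤h : lo ≤ h
  lo≤h = proj₁ (All.lookup inRange h∈xs)
  rest-unique : Unique (as ++ bs)
  rest-unique = UP.++⁺ uas ubs (λ (p , q) → disj (p , there q))
  h∉rest : h ∉ as ++ bs
  h∉rest h∈rest with ∈-++⁻ as h∈rest
  ... | inj₁ h∈as = disj (h∈as , here refl)
  ... | inj₂ h∈bs = All.lookup h∉bs h∈bs refl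
  below-h : All (λ y → lo ≤ y × y < h) (as ++ bs)
  below-h = All.tabulate (λ {y} y∈rest →
    let lo≤y , y≤h = All.lookup inRange (∈-++-∷⁺ as y∈rest) in
    lo≤y , ≤∧≢⇒< (≤-pred y≤h) (λ { refl → h∉rest y∈rest }))

countB-map : ∀ {A B : Set} (p : B → Bool) (g : A → B) xs → countB p (map g xs) ≡ countB (p ∘ g) xs
countB-map p g []       = refl
countB-map p g (x ∷ xs) = cong (indicator (p (g x)) +_) (countB-map p g xs)

countB-cong : ∀ {A : Set} {p q : A → Bool} xs → (∀ {x} → x ∈ xs → p x ≡ q x) → countB p xs ≡ countB q xs
countB-cong []       _   = refl
countB-cong (x ∷ xs) p≡q = cong₂ _+_ (cong indicator (p≡q (here refl))) (countB-cong xs (p≡q ∘ there))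

countB-↭ : ∀ {A : Set} (p : A → Bool) {xs ys} → xs ↭ ys → countB p xs ≡ countB p ys
countB-↭ p ↭-refl           = refl
countB-↭ p (prep x xs↭ys)   = cong (indicator (p x) +_) (countB-↭ p xs↭ys)
countB-↭ p (swap x y xs↭ys) =
  trans (cong (λ n → indicator (p x) + (indicator (p y) + n)) (countB-↭ p xs↭ys)) (x∙yz≈y∙xz (indicator (p x)) (indicator (p y)) _)
countB-↭ p (↭-trans xs↭ys ys↭zs) = trans (countB-↭ p xs↭ys) (countB-↭ p ys↭zs)

countB-involution : ∀ {A : Set} (p q : A → Bool) (g : A → A) {xs} → Unique xs →
  (∀ x → g (g x) ≡ x) → (∀ {x} → x ∈ xs → g x ∈ xs) → (∀ {x} → x ∈ xs → p x ≡ q (g x)) →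
  countB p xs ≡ countB q xs
countB-involution p q g {xs} u g∘g≡id closed p≡q∘g = begin
  countB p xs         ≡⟨ countB-cong xs p≡q∘g ⟩
  countB (q ∘ g) xs   ≡⟨ countB-map q g xs ⟨
  countB q (map g xs) ≡⟨ countB-↭ q (∼bag⇒↭ (unique∧set⇒bag (UP.map⁺ g-injective u) u (mk⇔ ⊆xs ⊇xs))) ⟩
  countB q xs ∎
  where
  open ≡-Reasoning
  g-injective : ∀ {x y} → g x ≡ g y → x ≡ y
  g-injective {x} {y} gx≡gy = trans (sym (g∘g≡id x)) (trans (cong g gx≡gy) (g∘g≡id y))
  ⊆xs : ∀ {y} → y ∈ map g xs → y ∈ xs
  ⊆xs y∈ with ∈-map⁻ g y∈
  ... | x , x∈xs , refl = closed x∈xs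
  ⊇xs : ∀ {y} → y ∈ xs → y ∈ map g xs
  ⊇xs {y} y∈xs = subst (_∈ map g xs) (g∘g≡id y) (∈-map⁺ g (closed y∈xs))

∈-words⁻ : ∀ n m {σ} → σ ∈ words n m → length σ ≡ m × All (_< n) σ
∈-words⁻ n zero    (here refl) = refl , []
∈-words⁻ n (suc m) σ∈ with find (∈-concatMap⁻ (λ i → map (toℕ i ∷_) (words n m)) {xs = allFin n} σ∈)
... | i , _ , σ∈i∷ with ∈-map⁻ (toℕ i ∷_) σ∈i∷
...   | w , w∈ , refl = let length-w , w<n = ∈-words⁻ n m w∈ in cong suc length-w , toℕ<n i ∷ w<n

∈-words⁺ : ∀ n {σ} → All (_< n) σ → σ ∈ words n (length σ)
∈-words⁺ n []                 = here refl
∈-words⁺ n {x ∷ σ} (x<n ∷ σ<n) =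
  ∈-concatMap⁺ (λ i → map (toℕ i ∷_) (words n (length σ))) {xs = allFin n}
    (lose (∈-allFin (fromℕ< x<n))
      (subst (λ y → x ∷ σ ∈ map (y ∷_) (words n (length σ))) (sym (toℕ-fromℕ< x<n))
        (∈-map⁺ (x ∷_) (∈-words⁺ n σ<n))))

words-unique : ∀ n m → Unique (words n m)
words-unique n zero    = [] ∷ []
words-unique n (suc m) = UP.concat⁺
  (map⁺ (All.universal (λ i → UP.map⁺ ∷-injectiveʳ (words-unique n m)) (allFin n)))
  (AllPairs.map⁺ (AllPairs.map disjoint (UP.allFin⁺ n)))
  where
  disjoint : ∀ {i j} → i ≢ j → Disjoint (map (toℕ i ∷_) (words n m)) (map (toℕ j ∷_) (words n m))
  disjoint i≢j (v∈i , v∈j) with ∈-map⁻ _ v∈i | ∈-map⁻ _ v∈j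
  ... | _ , _ , refl | _ , _ , v≡ = i≢j (toℕ-injective (∷-injectiveˡ v≡))

-- In  map suc u ++ 0 ∷ map (suc d +_) v  the entry 0 is below everything, so the only
-- consecutive patterns through it are 0 followed by an initial ascent of v (a 123) and a
-- final descent of u followed by 0 (a 321).
occ123-0∷ : ∀ d v → occ123 (0 ∷ map (suc d +_) v) ≡ initialAscent v + occ123 v
occ123-0∷ d []           = refl
occ123-0∷ d (_ ∷ [])     = refl
occ123-0∷ d (y ∷ y' ∷ r) =
  cong₂ _+_ (cong indicator (+-cancelˡ-<ᵇ (suc d) y y')) (Shift.occ123-map (suc d) (y ∷ y' ∷ r))

occ123-node : ∀ d u v →
  occ123 (map suc u ++ 0 ∷ map (suc d +_) v) ≡ occ123 u + (initialAscent v + occ123 v)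
occ123-node d []                v       = occ123-0∷ d v
occ123-node d (_ ∷ [])          []      = refl
occ123-node d (_ ∷ [])          (y ∷ v) = occ123-0∷ d (y ∷ v)
occ123-node d (x ∷ x' ∷ [])     v       =
  cong₂ _+_ (cong indicator (∧-zeroʳ (x <ᵇ x'))) (occ123-node d (x' ∷ []) v)
occ123-node d (x ∷ x' ∷ x'' ∷ r) v      = begin
  i + occ123 (map suc w ++ 0 ∷ map (suc d +_) v)
    ≡⟨ cong (i +_) (occ123-node d (x' ∷ x'' ∷ r) v) ⟩
  i + (occ123 w + (initialAscent v + occ123 v))
    ≡⟨ +-assoc i _ _ ⟨
  (i + occ123 w) + (initialAscent v + occ123 v) ∎
  where
  open ≡-Reasoning
  i = indicator ((x <ᵇ x') ∧ (x' <ᵇ x''))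
  w = x' ∷ x'' ∷ r

occ321-0∷ : ∀ d v → occ321 (0 ∷ map (suc d +_) v) ≡ occ321 v
occ321-0∷ d []           = refl
occ321-0∷ d (_ ∷ [])     = refl
occ321-0∷ d (y ∷ y' ∷ r) = Shift.occ321-map (suc d) (y ∷ y' ∷ r)

occ321-node : ∀ d u v →
  occ321 (map suc u ++ 0 ∷ map (suc d +_) v) ≡ (occ321 u + finalDescent u) + occ321 v
occ321-node d []                 v       = occ321-0∷ d v
occ321-node d (_ ∷ [])           []      = refl
occ321-node d (_ ∷ [])           (y ∷ v) = occ321-0∷ d (y ∷ v)
occ321-node d (x ∷ x' ∷ [])      v       =
  cong₂ _+_ (cong indicator (∧-identityʳ (x' <ᵇ x))) (occ321-node d (x' ∷ []) v)
occ321-node d (x ∷ x' ∷ x'' ∷ r) v       = begin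
  i + occ321 (map suc w ++ 0 ∷ map (suc d +_) v)
    ≡⟨ cong (i +_) (occ321-node d (x' ∷ x'' ∷ r) v) ⟩
  i + ((occ321 w + finalDescent w) + occ321 v)
    ≡⟨ +-assoc i _ _ ⟨
  (i + (occ321 w + finalDescent w)) + occ321 v
    ≡⟨ cong (_+ occ321 v) (+-assoc i _ _) ⟨
  ((i + occ321 w) + finalDescent w) + occ321 v ∎
  where
  open ≡-Reasoning
  i = indicator ((x' <ᵇ x) ∧ (x'' <ᵇ x'))
  w = x' ∷ x'' ∷ r

initialAscent-node : ∀ d u v →
  initialAscent (map suc u ++ 0 ∷ map (suc d +_) v)
    ≡ (if null u then (if null v then 0 else 1) else initialAscent u)
initialAscent-node d []           []      = refl
initialAscent-node d []           (_ ∷ _) = refl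
initialAscent-node d (_ ∷ [])     _       = refl
initialAscent-node d (_ ∷ _ ∷ _)  _       = refl

finalDescent-node : ∀ d u v →
  finalDescent (map suc u ++ 0 ∷ map (suc d +_) v)
    ≡ (if null v then (if null u then 0 else 1) else finalDescent v)
finalDescent-node d []                 []           = refl
finalDescent-node d []                 (_ ∷ [])     = refl
finalDescent-node d []                 (y ∷ y' ∷ r) = Shift.finalDescent-map (suc d) (y ∷ y' ∷ r)
finalDescent-node d (_ ∷ [])           []           = refl
finalDescent-node d (_ ∷ [])           (_ ∷ [])     = refl
finalDescent-node d (_ ∷ [])           (y ∷ y' ∷ r) = Shift.finalDescent-map (suc d) (y ∷ y' ∷ r)
finalDescent-node d (_ ∷ x ∷ [])       v            = finalDescent-node d (x ∷ []) v
finalDescent-node d (_ ∷ x ∷ y ∷ u)    v            = finalDescent-node d (x ∷ y ∷ u) v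

-- Binary trees and their permutations

data Tree : Set where
  leaf : Tree
  node : Tree → Tree → Tree

size : Tree → ℕ
size leaf       = 0
size (node l r) = suc (size l + size r)

mirror : Tree → Tree
mirror leaf       = leaf
mirror (node l r) = node (mirror r) (mirror l)

mirror-involutive : ∀ t → mirror (mirror t) ≡ t
mirror-involutive leaf       = refl
mirror-involutive (node l r) = cong₂ node (mirror-involutive l) (mirror-involutive r)

size-mirror : ∀ t → size (mirror t) ≡ size t
size-mirror leaf       = refl
size-mirror (node l r) =
  cong suc (trans (cong₂ _+_ (size-mirror r) (size-mirror l)) (+-comm (size r) (size l)))

toPerm : Tree → List ℕ
toPerm leaf       = []
toPerm (node l r) = map suc (toPerm l) ++ 0 ∷ map (suc (size l) +_) (toPerm r)

length-toPerm : ∀ t → length (toPerm t) ≡ size t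
length-toPerm leaf       = refl
length-toPerm (node l r) = trans (length-++-∷ (map suc (toPerm l))) (cong suc (cong₂ _+_
  (trans (length-map suc (toPerm l)) (length-toPerm l))
  (trans (length-map (suc (size l) +_) (toPerm r)) (length-toPerm r))))

null-toPerm-mirror : ∀ t → null (toPerm (mirror t)) ≡ null (toPerm t)
null-toPerm-mirror leaf       = refl
null-toPerm-mirror (node l r) =
  trans (null-++-∷ (map suc (toPerm (mirror r)))) (sym (null-++-∷ (map suc (toPerm l))))
  where
  null-++-∷ : ∀ xs {y ys} → null (xs ++ y ∷ ys) ≡ false
  null-++-∷ []      = refl
  null-++-∷ (_ ∷ _) = refl

finalDescent-mirror : ∀ t → finalDescent (toPerm (mirror t)) ≡ initialAscent (toPerm t)
finalDescent-mirror leaf       = refl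
finalDescent-mirror (node l r) = begin
  finalDescent (toPerm (node (mirror r) (mirror l)))
    ≡⟨ finalDescent-node (size (mirror r)) (toPerm (mirror r)) (toPerm (mirror l)) ⟩
  (if null (toPerm (mirror l)) then (if null (toPerm (mirror r)) then 0 else 1)
   else finalDescent (toPerm (mirror l)))
    ≡⟨ cong₂ (λ a b → if a then (if b then 0 else 1) else finalDescent (toPerm (mirror l)))
         (null-toPerm-mirror l) (null-toPerm-mirror r) ⟩
  (if null (toPerm l) then (if null (toPerm r) then 0 else 1) else finalDescent (toPerm (mirror l)))
    ≡⟨ cong (if null (toPerm l) then (if null (toPerm r) then 0 else 1) else_) (finalDescent-mirror l) ⟩
  (if null (toPerm l) then (if null (toPerm r) then 0 else 1) else initialAscent (toPerm l))
    ≡⟨ sym (initialAscent-node (size l) (toPerm l) (toPerm r)) ⟩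
  initialAscent (toPerm (node l r)) ∎
  where open ≡-Reasoning

occ321-mirror : ∀ t → occ321 (toPerm (mirror t)) ≡ occ123 (toPerm t)
occ321-mirror leaf       = refl
occ321-mirror (node l r) = begin
  occ321 (toPerm (node (mirror r) (mirror l)))
    ≡⟨ occ321-node (size (mirror r)) (toPerm (mirror r)) (toPerm (mirror l)) ⟩
  (occ321 (toPerm (mirror r)) + finalDescent (toPerm (mirror r))) + occ321 (toPerm (mirror l))
    ≡⟨ cong₂ _+_ (cong₂ _+_ (occ321-mirror r) (finalDescent-mirror r)) (occ321-mirror l) ⟩
  (occ123 (toPerm r) + initialAscent (toPerm r)) + occ123 (toPerm l)
    ≡⟨ +-comm _ (occ123 (toPerm l)) ⟩
  occ123 (toPerm l) + (occ123 (toPerm r) + initialAscent (toPerm r))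
    ≡⟨ cong (occ123 (toPerm l) +_) (+-comm (occ123 (toPerm r)) _) ⟩
  occ123 (toPerm l) + (initialAscent (toPerm r) + occ123 (toPerm r))
    ≡⟨ sym (occ123-node (size l) (toPerm l) (toPerm r)) ⟩
  occ123 (toPerm (node l r)) ∎
  where open ≡-Reasoning

toPerm-bounded : ∀ t → All (_< size t) (toPerm t)
toPerm-bounded leaf       = []
toPerm-bounded (node l r) = ++⁺
  (map⁺ (All.map (λ x<l → s≤s (≤-trans x<l (m≤m+n (size l) (size r)))) (toPerm-bounded l)))
  (z<s ∷ map⁺ (All.map (λ y<r → s≤s (+-monoʳ-< (size l) y<r)) (toPerm-bounded r)))

module _ (l r : Tree) where

  private
    L = map suc (toPerm l)
    R = map (suc (size l) +_) (toPerm r)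

    L≤size : All (_≤ size l) L
    L≤size = map⁺ (toPerm-bounded l)

    size<R : All (size l <_) R
    size<R = map⁺ (All.universal (λ y → m≤m+n (suc (size l)) y) (toPerm r))

    L<R : ∀ {x z} → x ∈ L → z ∈ R → x < z
    L<R x∈L z∈R = ≤-<-trans (All.lookup L≤size x∈L) (All.lookup size<R z∈R)

  toPerm-node-unique : Unique (toPerm l) → Unique (toPerm r) → Unique (toPerm (node l r))
  toPerm-node-unique ul ur = UP.++⁺ (UP.map⁺ suc-injective ul)
    (map⁺ (All.universal (λ _ ()) (toPerm r)) ∷ UP.map⁺ (+-cancelˡ-≡ (suc (size l)) _ _) ur)
    λ { (x∈L , here refl) → case ∈-map⁻ suc x∈L of λ { (_ , _ , ()) }
      ; (x∈L , there x∈R) → <-irrefl refl (L<R x∈L x∈R) }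

  -- toPerm (node l r) = (L ++ [0]) ++ R, where everything in L ++ [0] is below everything in R
  -- and 0 is below everything in L.
  toPerm-node-avoids312 : T (avoids312 (toPerm l)) → T (avoids312 (toPerm r)) →
                          T (avoids312 (toPerm (node l r)))
  toPerm-node-avoids312 avl avr = subst (T ∘ avoids312) (++-assoc L [ 0 ] R)
    (avoids312-++⁺ (L ++ [ 0 ]) R avL0 avR
      (λ x∈L0 h → let z , z∈R , z<x = has12below-below _ R h in <-asym z<x (L0<R x∈L0 z∈R))
      (λ x∈L0 _ z∈R _ z<x → <-asym z<x (L0<R x∈L0 z∈R)))
    where
    avL0 : T (avoids312 (L ++ [ 0 ]))
    avL0 = avoids312-++⁺ L [ 0 ] (subst T (sym (Shift.avoids312-map 1 (toPerm l))) avl) _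
      (λ _ ()) (λ { _ _ (here refl) () _ })
    avR : T (avoids312 R)
    avR = subst T (sym (Shift.avoids312-map (suc (size l)) (toPerm r))) avr
    L0<R : ∀ {x z} → x ∈ L ++ [ 0 ] → z ∈ R → x < z
    L0<R x∈L0 z∈R with ∈-++⁻ L x∈L0
    ... | inj₁ x∈L        = L<R x∈L z∈R
    ... | inj₂ (here refl) = ≤-<-trans z≤n (All.lookup size<R z∈R)

toPerm-unique : ∀ t → Unique (toPerm t)
toPerm-unique leaf       = []
toPerm-unique (node l r) = toPerm-node-unique l r (toPerm-unique l) (toPerm-unique r)

toPerm-avoids312 : ∀ t → T (avoids312 (toPerm t))
toPerm-avoids312 leaf       = _
toPerm-avoids312 (node l r) = toPerm-node-avoids312 l r (toPerm-avoids312 l) (toPerm-avoids312 r)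

++-0∷-injective : ∀ u u' {v v'} → map suc u ++ 0 ∷ v ≡ map suc u' ++ 0 ∷ v' → u ≡ u' × v ≡ v'
++-0∷-injective []      []        eq = refl , ∷-injectiveʳ eq
++-0∷-injective []      (_ ∷ _)   eq = case ∷-injectiveˡ eq of λ ()
++-0∷-injective (_ ∷ _) []        eq = case ∷-injectiveˡ eq of λ ()
++-0∷-injective (x ∷ u) (x' ∷ u') eq with ∷-injective eq
... | refl , eq' = let u≡u' , v≡v' = ++-0∷-injective u u' eq' in cong (x ∷_) u≡u' , v≡v'

toPerm-injective : ∀ {t t'} → toPerm t ≡ toPerm t' → t ≡ t'
toPerm-injective {leaf}     {leaf}       _  = refl
toPerm-injective {leaf}     {node l r}   eq = case ++-conicalʳ (map suc (toPerm l)) _ (sym eq) of λ ()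
toPerm-injective {node l r} {leaf}       eq = case ++-conicalʳ (map suc (toPerm l)) _ eq of λ ()
toPerm-injective {node l r} {node l' r'} eq with ++-0∷-injective (toPerm l) (toPerm l') eq
... | L≡L' , R≡R' with toPerm-injective {l} {l'} L≡L'
... | refl = cong (node l) (toPerm-injective (map-injective (+-cancelˡ-≡ (suc (size l)) _ _) R≡R'))

-- xs is a 312-avoiding arrangement of the values c, c + 1, …, c + length xs − 1;
-- for c = 0 these are the 312-avoiding permutations.
record Is312Block (c : ℕ) (xs : List ℕ) : Set where
  field
    unique  : Unique xs
    inRange : All (λ x → c ≤ x × x < c + length xs) xs
    avoids  : T (avoids312 xs)

toPerm-Is312Block : ∀ t → Is312Block 0 (toPerm t)
toPerm-Is312Block t = record
  { unique  = toPerm-unique t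
  ; inRange = All.map (z≤n ,_)
                (subst (λ n → All (_< n) (toPerm t)) (sym (length-toPerm t)) (toPerm-bounded t))
  ; avoids  = toPerm-avoids312 t
  }

Is312Block-unshift : ∀ c {xs} → Is312Block c xs →
  Is312Block 0 (map (_∸ c) xs) × map (c +_) (map (_∸ c) xs) ≡ xs
Is312Block-unshift c {xs} b = record
  { unique  = UP.map⁻ (subst Unique (sym reshift) unique)
  ; inRange = subst (λ n → All (λ y → 0 ≤ y × y < n) (map (_∸ c) xs)) (sym (length-map (_∸ c) xs))
                (map⁺ (All.map (λ (c≤x , x<c+n) →
                  z≤n , +-cancelˡ-< c _ _ (subst (_< _) (sym (m+[n∸m]≡n c≤x)) x<c+n)) inRange))
  ; avoids  = subst T (Shift.avoids312-map c (map (_∸ c) xs)) (subst (T ∘ avoids312) (sym reshift) avoids)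
  } , reshift
  where
  open Is312Block b
  reshift : map (c +_) (map (_∸ c) xs) ≡ xs
  reshift = trans (sym (map-∘ xs)) (map-id-local (All.map (m+[n∸m]≡n ∘ proj₁) inRange))

module _ {α β : List ℕ} (b : Is312Block 0 (α ++ 0 ∷ β)) where

  open Is312Block b

  private
    α#0β : Disjoint α (0 ∷ β)
    α#0β = proj₂ (proj₂ (Unique-++⁻ α unique))

    0∷β-unique : Unique (0 ∷ β)
    0∷β-unique = proj₁ (proj₂ (Unique-++⁻ α unique))

    α-positive : ∀ {x} → x ∈ α → 0 < x
    α-positive x∈α = n≢0⇒n>0 (λ { refl → α#0β (x∈α , here refl) })

    β-positive : ∀ {z} → z ∈ β → 0 < z
    β-positive z∈β with 0∷β-unique
    ... | 0∉β ∷ _ = n≢0⇒n>0 (All.lookup 0∉β z∈β ∘ sym)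

    α<n : All (_< length (α ++ 0 ∷ β)) α
    α<n = All.map proj₂ (++⁻ˡ α inRange)

    β<n : All (_< length (α ++ 0 ∷ β)) β
    β<n with ++⁻ʳ α inRange
    ... | _ ∷ β-inRange = All.map proj₂ β-inRange

    -- z < x would make x, 0, z an occurrence of 312.
    α<β : ∀ {x z} → x ∈ α → z ∈ β → x < z
    α<β {x} {z} x∈α z∈β = ≤∧≢⇒< (≮⇒≥ z≮x) (λ { refl → α#0β (x∈α , there z∈β) })
      where
      z≮x : ¬ z < x
      z≮x z<x = proj₂ (proj₂ (avoids312-++⁻ α (0 ∷ β) avoids)) x∈α
        (Equivalence.from T-∨ (inj₁ (any⁺ _ (lose z∈β
          (Equivalence.from T-∧ (<⇒<ᵇ (β-positive z∈β) , <⇒<ᵇ z<x))))))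

  left-Is312Block : Is312Block 1 α
  left-Is312Block = record
    { unique  = proj₁ (Unique-++⁻ α unique)
    ; inRange = All.tabulate λ x∈α → α-positive x∈α , s≤s (x≤length-α x∈α)
    ; avoids  = proj₁ (avoids312-++⁻ α (0 ∷ β) avoids)
    }
    where
    -- β lies in [x + 1, n), so it has at most n − x − 1 entries.
    x≤length-α : ∀ {x} → x ∈ α → x ≤ length α
    x≤length-α {x} x∈α = +-cancelˡ-≤ (length β) x (length α) (s≤s⁻¹ (begin
      suc (length β + x)        ≡⟨ +-suc (length β) x ⟨
      length β + suc x          ≤⟨ m≤o∸n⇒m+n≤o (length β) (All.lookup α<n x∈α)
                                     (Unique-bounded⇒length≤ (suc x) _ (tail 0∷β-unique)
                                       (All.tabulate λ z∈β → α<β x∈α z∈β , All.lookup β<n z∈β)) ⟩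
      length (α ++ 0 ∷ β)       ≡⟨ length-++-∷ α ⟩
      suc (length α + length β) ≡⟨ cong suc (+-comm (length α) (length β)) ⟩
      suc (length β + length α) ∎))
      where open ≤-Reasoning

  right-Is312Block : Is312Block (suc (length α)) β
  right-Is312Block = record
    { unique  = tail 0∷β-unique
    ; inRange = All.tabulate λ z∈β → length-α<z z∈β , subst (_ <_) (length-++-∷ α) (All.lookup β<n z∈β)
    ; avoids  = proj₂ (avoids312-∷⁻ 0 β (proj₁ (proj₂ (avoids312-++⁻ α (0 ∷ β) avoids))))
    }
    where
    -- α lies in [1, z), so it has at most z − 1 entries.
    length-α<z : ∀ {z} → z ∈ β → length α < z
    length-α<z {z} z∈β = subst (_≤ z) (+-comm (length α) 1) (m≤o∸n⇒m+n≤o (length α) (β-positive z∈β)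
      (Unique-bounded⇒length≤ 1 z (proj₁ (Unique-++⁻ α unique))
        (All.tabulate λ x∈α → α-positive x∈α , α<β x∈α z∈β)))

Is312Block-0∉⇒[] : ∀ {σ} → Is312Block 0 σ → 0 ∉ σ → σ ≡ []
Is312Block-0∉⇒[] {[]}     _ _   = refl
Is312Block-0∉⇒[] {x ∷ xs} b 0∉σ = ⊥-elim (1+n≰n (Unique-bounded⇒length≤ 1 (suc (length xs)) unique
  (All.tabulate λ {y} y∈σ → n≢0⇒n>0 (λ { refl → 0∉σ y∈σ }) , proj₂ (All.lookup inRange y∈σ))))
  where open Is312Block b

decompose-step : ∀ α β → Is312Block 0 (α ++ 0 ∷ β) →
  (∀ {σ} → Is312Block 0 σ → length σ < length (α ++ 0 ∷ β) → ∃ λ t → toPerm t ≡ σ) →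
  ∃ λ t → toPerm t ≡ α ++ 0 ∷ β
decompose-step α β b decompose-shorter =
  let bα , reshiftα = Is312Block-unshift 1 (left-Is312Block b)
      bβ , reshiftβ = Is312Block-unshift (suc (length α)) (right-Is312Block b)
      tα , toPermα  = decompose-shorter bα
                        (subst₂ _<_ (sym (length-map _ α)) (sym (length-++-∷ α)) (s≤s (m≤m+n _ _)))
      tβ , toPermβ  = decompose-shorter bβ
                        (subst₂ _<_ (sym (length-map _ β)) (sym (length-++-∷ α)) (s≤s (m≤n+m _ _)))
      size-tα : size tα ≡ length α
      size-tα       = trans (sym (length-toPerm tα)) (trans (cong length toPermα) (length-map _ α))
  in node tα tβ , (begin
    map suc (toPerm tα) ++ 0 ∷ map (suc (size tα) +_) (toPerm tβ)
      ≡⟨ cong₂ (λ u k → map suc u ++ 0 ∷ map (suc k +_) (toPerm tβ)) toPermα size-tα ⟩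
    map suc (map (_∸ 1) α) ++ 0 ∷ map (suc (length α) +_) (toPerm tβ)
      ≡⟨ cong₂ (λ u v → u ++ 0 ∷ v) reshiftα (trans (cong (map _) toPermβ) reshiftβ) ⟩
    α ++ 0 ∷ β ∎)
  where open ≡-Reasoning

decompose : ∀ σ → Is312Block 0 σ → ∃ λ t → toPerm t ≡ σ
decompose σ = go σ (<-wellFounded (length σ))
  where
  go : ∀ σ → Acc _<_ (length σ) → Is312Block 0 σ → ∃ λ t → toPerm t ≡ σ
  go σ (acc rec) b with 0 ∈? σ
  ... | no 0∉σ = leaf , sym (Is312Block-0∉⇒[] b 0∉σ)
  ... | yes 0∈σ with ∈-∃++ 0∈σ
  ...   | α , β , refl = decompose-step α β b (λ b' shorter → go _ (rec shorter) b')

-- Mirroring 312-avoiding permutations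

is312Perm? : ∀ σ → Dec (Is312Block 0 σ)
is312Perm? σ = map′ (λ (u , r , a) → record { unique = u ; inRange = r ; avoids = a })
  (λ b → let open Is312Block b in unique , inRange , avoids)
  (unique? σ ×-dec All.all? (λ x → yes z≤n ×-dec x <? length σ) σ ×-dec T? (avoids312 σ))

mirror312 : List ℕ → List ℕ
mirror312 σ with is312Perm? σ
... | yes b = toPerm (mirror (proj₁ (decompose σ b)))
... | no  _ = σ

mirror312-toPerm : ∀ t → mirror312 (toPerm t) ≡ toPerm (mirror t)
mirror312-toPerm t with is312Perm? (toPerm t)
... | no ¬b = ⊥-elim (¬b (toPerm-Is312Block t))
... | yes b with decompose (toPerm t) b
...   | t' , toPerm-t'≡ = cong (toPerm ∘ mirror) (toPerm-injective {t'} {t} toPerm-t'≡)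

mirror312-other : ∀ {σ} → ¬ Is312Block 0 σ → mirror312 σ ≡ σ
mirror312-other {σ} ¬b with is312Perm? σ
... | yes b = ⊥-elim (¬b b)
... | no  _ = refl

data View312 : List ℕ → Set where
  tree  : ∀ t → View312 (toPerm t)
  other : ∀ {σ} → ¬ Is312Block 0 σ → View312 σ

view312 : ∀ σ → View312 σ
view312 σ with is312Perm? σ
... | no ¬b = other ¬b
... | yes b with decompose σ b
...   | t , refl = tree t

mirror312-involutive : ∀ σ → mirror312 (mirror312 σ) ≡ σ
mirror312-involutive σ with view312 σ
... | tree t   = begin
  mirror312 (mirror312 (toPerm t)) ≡⟨ cong mirror312 (mirror312-toPerm t) ⟩
  mirror312 (toPerm (mirror t))    ≡⟨ mirror312-toPerm (mirror t) ⟩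
  toPerm (mirror (mirror t))       ≡⟨ cong toPerm (mirror-involutive t) ⟩
  toPerm t ∎
  where open ≡-Reasoning
... | other ¬b = trans (cong mirror312 (mirror312-other ¬b)) (mirror312-other ¬b)

mirror312-words : ∀ n {σ} → σ ∈ words n n → mirror312 σ ∈ words n n
mirror312-words n {σ} σ∈ with view312 σ | σ∈
... | other ¬b | σ∈ = subst (_∈ words n n) (sym (mirror312-other ¬b)) σ∈
... | tree t   | σ∈ = subst (_∈ words n n) (sym (mirror312-toPerm t))
  (subst (λ m → toPerm (mirror t) ∈ words n m) (trans (length-toPerm (mirror t)) size≡n)
    (∈-words⁺ n (subst (λ m → All (_< m) (toPerm (mirror t))) size≡n (toPerm-bounded (mirror t)))))
  where
  size≡n : size (mirror t) ≡ n
  size≡n = trans (size-mirror t) (trans (sym (length-toPerm t)) (proj₁ (∈-words⁻ n n σ∈)))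

selected : (List ℕ → ℕ) → ℕ → List ℕ → Bool
selected occ k σ = isPerm σ ∧ avoids312 σ ∧ (occ σ ≡ᵇ k)

selected-toPerm : ∀ occ k t → selected occ k (toPerm t) ≡ (occ (toPerm t) ≡ᵇ k)
selected-toPerm occ k t rewrite Equivalence.to T-≡ (Unique⇒distinct (toPerm-unique t))
                              | Equivalence.to T-≡ (toPerm-avoids312 t) = refl

selected-non312 : ∀ occ k {σ} → All (_< length σ) σ → ¬ Is312Block 0 σ → selected occ k σ ≡ false
selected-non312 occ k {σ} σ<n ¬b with distinct σ in d | avoids312 σ in av
... | true  | true  = ⊥-elim (¬b record
  { unique  = distinct⇒Unique σ (subst T (sym d) _)
  ; inRange = All.map (z≤n ,_) σ<n
  ; avoids  = subst T (sym av) _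
  })
... | true  | false = refl
... | false | _     = refl

mirror312-selected : ∀ n k {σ} → σ ∈ words n n → selected occ123 k σ ≡ selected occ321 k (mirror312 σ)
mirror312-selected n k {σ} σ∈ with view312 σ | σ∈
... | tree t   | _  = begin
  selected occ123 k (toPerm t)              ≡⟨ selected-toPerm occ123 k t ⟩
  (occ123 (toPerm t) ≡ᵇ k)                  ≡⟨ cong (_≡ᵇ k) (occ321-mirror t) ⟨
  (occ321 (toPerm (mirror t)) ≡ᵇ k)         ≡⟨ selected-toPerm occ321 k (mirror t) ⟨
  selected occ321 k (toPerm (mirror t))     ≡⟨ cong (selected occ321 k) (mirror312-toPerm t) ⟨
  selected occ321 k (mirror312 (toPerm t)) ∎
  where open ≡-Reasoning
... | other ¬b | σ∈ = begin
  selected occ123 k σ             ≡⟨ selected-non312 occ123 k σ<n ¬b ⟩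
  false                           ≡⟨ selected-non312 occ321 k σ<n ¬b ⟨
  selected occ321 k σ             ≡⟨ cong (selected occ321 k) (mirror312-other ¬b) ⟨
  selected occ321 k (mirror312 σ) ∎
  where
  open ≡-Reasoning
  σ<n : All (_< length σ) σ
  σ<n = let length≡n , σ<n = ∈-words⁻ n n σ∈ in subst (λ m → All (_< m) σ) (sym length≡n) σ<n

theorem8 : ∀ (n k : ℕ) → a occ123 n k ≡ a occ321 n k
theorem8 n k = countB-involution (selected occ123 k) (selected occ321 k) mirror312 (words-unique n n)
  mirror312-involutive (mirror312-words n) (mirror312-selected n k)
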